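{- Let $S$ be a zigzag stack on $[n]$ with $n\ge 1$, and let $C$ be its primary component. Then no arc of $S$ joins two vertices lying in two different $C$-intervals. Consequently $S$ is the union of $C$ and of the (zigzag) substructures of $S$ on its $C$-intervals.
   Context: $[n]=\{1,\dots,n\}$. A diagram on $[n]$ is a simple graph on vertex set $[n]$, vertices drawn in increasing order on a line; an edge $\{i,j\}$ with $i<j$ is an arc $(i,j)$. Arcs $(i_1,j_1),(i_2,j_2)$ cross if $i_1<i_2<j_1<j_2$; a stack is a diagram without crossing arcs. For a vertex $v$, $\mathrm{ld}(v)$ is the number of arcs $(i,v)$ with $i<v$, $\mathrm{rd}(v)$ the number of arcs $(v,j)$ with $j>v$, and $\deg(v)=\mathrm{ld}(v)+\mathrm{rd}(v)$. A zigzag stack is a stack in which every vertex has degree at most $2$ and no vertex $v$ has both $\mathrm{ld}(v)>0$ and $\mathrm{rd}(v)>0$ (isolated vertices are allowed). The primary component of $S$ is the connected component (as a graph) containing vertex $1$. If the vertices of $C$ are $c_1<c_2<\dots<c_k$, the $C$-intervals are the (possibly empty) sets $\{c_t+1,\dots,c_{t+1}-1\}$ for $1\le t\le k-1$, together with $\{c_k+1,\dots,n\}$ when $c_k<n$. The substructure of $S$ on a set of consecutive integers $I$ is the diagram formed by the vertices of $I$ and the arcs of $S$ with both ends in $I$. -}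

module Defs where

open import Data.Nat using (ℕ; zero; suc; _+_; _≤_; _<_; _<ᵇ_)
open import Data.Bool using (Bool; true; false; if_then_else_; _∧_)
open import Data.Product using (Σ; _×_; ∃-syntax)
open import Data.Sum using (_⊎_)
open import Relation.Nullary using (¬_)
open import Relation.Binary.PropositionalEquality using (_≡_)

Arcs : Set
Arcs = ℕ → ℕ → Bool

record Diagram (n : ℕ) : Set where
  field
    arc : Arcs
    arc-wf : ∀ i j → arc i j ≡ true → 1 ≤ i × i < j × j ≤ n
open Diagram public

count : (ℕ → Bool) → ℕ → ℕ
count f zero = 0
count f (suc k) = count f k + (if f k then 1 else 0)

ld : ∀ {n} → Diagram n → ℕ → ℕ
ld S v = count (λ i → arc S i v) v

rd : ∀ {n} → Diagram n → ℕ → ℕ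
rd {n} S v = count (λ j → (v <ᵇ j) ∧ arc S v j) (suc n)

deg : ∀ {n} → Diagram n → ℕ → ℕ
deg S v = ld S v + rd S v

Cross : ℕ → ℕ → ℕ → ℕ → Set
Cross i₁ j₁ i₂ j₂ = i₁ < i₂ × i₂ < j₁ × j₁ < j₂

IsStack : ∀ {n} → Diagram n → Set
IsStack S = ∀ i₁ j₁ i₂ j₂ → arc S i₁ j₁ ≡ true → arc S i₂ j₂ ≡ true →
            ¬ Cross i₁ j₁ i₂ j₂

IsZigzagStack : ∀ {n} → Diagram n → Set
IsZigzagStack {n} S =
  IsStack S ×
  (∀ v → 1 ≤ v → v ≤ n → deg S v ≤ 2) ×
  (∀ v → 1 ≤ v → v ≤ n → ¬ (0 < ld S v × 0 < rd S v))

data Reach {n : ℕ} (S : Diagram n) (x : ℕ) : ℕ → Set where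
  here : Reach S x x
  fwd  : ∀ {y z} → Reach S x y → arc S y z ≡ true → Reach S x z
  bwd  : ∀ {y z} → Reach S x y → arc S z y ≡ true → Reach S x z

-- v is a vertex of the primary component C (the component containing vertex 1)
InC : ∀ {n} → Diagram n → ℕ → Set
InC {n} S v = 1 ≤ v × v ≤ n × Reach S 1 v

-- x lies in the C-interval starting right after the C-vertex c:
-- i.e. x ∈ {c+1, …, c'−1} where c' is the next vertex of C after c,
-- or x ∈ {c+1, …, n} if c is the last vertex of C.
InInterval : ∀ {n} → Diagram n → ℕ → ℕ → Set
InInterval {n} S c x =
  InC S c × c < x × x ≤ n × (∀ m → c < m → m ≤ x → ¬ InC S m)

-- An arc (x, y) whose ends lie in different C-intervals would pass over a vertex c' of C
-- with x < c' < y. A path in C from 1 to c' starts left of x and meets neither x nor y, so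
-- one of its arcs jumps into the span (x, y) from the left of x, or leaves it to the right
-- of y; either way it crosses (x, y).
-- Membership in C is decidable: the sets of vertices within distance k of 1 grow with k,
-- and since they live in {0, …, n} their sizes force them to stabilise.
module Submission where

open import Defs
open import Data.Nat using (ℕ; zero; suc; _+_; _≤_; _<_; z≤n; s≤s; _≤?_; _≟_)
open import Data.Nat.Properties
open import Data.Bool using (Bool; true; false; T; if_then_else_)
open import Data.Bool.Properties using () renaming (_≟_ to _≟ᵇ_)
open import Data.Product using (_×_; _,_; proj₁; proj₂; ∃-syntax)
open import Data.Sum using (_⊎_; inj₁; inj₂)
open import Data.Empty using (⊥-elim)
open import Function using (_∘_)
open import Relation.Nullary using (¬_; Dec; yes; no)
open import Relation.Nullary.Decidable
  using (⌊_⌋; _×-dec_; _⊎-dec_; map′; toWitness; fromWitness; decidable-stable)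
open import Relation.Unary using (Pred; Decidable)
open import Relation.Binary using (tri<; tri≈; tri>)
open import Relation.Binary.PropositionalEquality using (_≡_; _≢_; refl; sym)

indicator-mono : ∀ {a b} → (T a → T b) → (if a then 1 else 0) ≤ (if b then 1 else 0)
indicator-mono {false}        _   = z≤n
indicator-mono {true} {true}  _   = ≤-refl
indicator-mono {true} {false} a⇒b = ⊥-elim (a⇒b _)

indicator-< : ∀ {a b} → ¬ T a → T b → (if a then 1 else 0) < (if b then 1 else 0)
indicator-< {false} {true} _  _ = s≤s z≤n
indicator-< {true}         ¬a _ = ⊥-elim (¬a _)

count-≤ : ∀ f m → count f m ≤ m
count-≤ f zero    = z≤n
count-≤ f (suc m) =
  ≤-trans (+-mono-≤ (count-≤ f m) (indicator-mono {b = true} _)) (≤-reflexive (+-comm m 1))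

module _ {f g : ℕ → Bool} where

  count-mono : ∀ m → (∀ {v} → v < m → T (f v) → T (g v)) → count f m ≤ count g m
  count-mono zero    _   = z≤n
  count-mono (suc m) f⇒g =
    +-mono-≤ (count-mono m (f⇒g ∘ m<n⇒m<1+n)) (indicator-mono (f⇒g ≤-refl))

  count-mono-< : ∀ m → (∀ {v} → v < m → T (f v) → T (g v)) →
                 ∀ {v} → v < m → ¬ T (f v) → T (g v) → count f m < count g m
  count-mono-< (suc m) f⇒g (s≤s v≤m) ¬fv gv with m≤n⇒m<n∨m≡n v≤m
  ... | inj₁ v<m  = +-mono-<-≤ (count-mono-< m (f⇒g ∘ m<n⇒m<1+n) v<m ¬fv gv)
                               (indicator-mono (f⇒g ≤-refl))
  ... | inj₂ refl = +-mono-≤-< (count-mono m (f⇒g ∘ m<n⇒m<1+n)) (indicator-< ¬fv gv)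

module _ {P : ℕ → ℕ → Set} (P? : ∀ k → Decidable (P k))
         (P-step : ∀ {k v} → P k v → P (suc k) v) (m : ℕ) where

  private
    size : ℕ → ℕ
    size k = count (λ v → ⌊ P? k v ⌋) m

    grows : ∀ k {v} → v < m → T ⌊ P? k v ⌋ → T ⌊ P? (suc k) v ⌋
    grows k _ = fromWitness ∘ P-step ∘ toWitness

    StableAt : ℕ → Set
    StableAt j = ∀ {v} → v < m → P (suc j) v → P j v

    equal-size⇒stable : ∀ k → size k ≡ size (suc k) → StableAt k
    equal-size⇒stable k eq {v} v<m p = decidable-stable (P? k v) λ ¬p →
      <-irrefl eq (count-mono-< m (grows k) v<m (¬p ∘ toWitness) (fromWitness p))

    -- as size k ≤ m, the bound says the size can grow at most t more times
    search : ∀ t k → m ≤ t + size k → ∃[ j ] StableAt j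
    search t k m≤t+size with size k ≟ size (suc k)
    ... | yes eq = k , equal-size⇒stable k eq
    ... | no neq with t | ≤∧≢⇒< (count-mono m (grows k)) neq
    ...   | zero  | grew = ⊥-elim (<⇒≱ grew (≤-trans (count-≤ _ m) m≤t+size))
    ...   | suc t | grew = search t (suc k)
      (≤-trans m≤t+size (≤-trans (≤-reflexive (sym (+-suc t (size k)))) (+-monoʳ-≤ t grew)))

  stabilises : ∃[ j ] (∀ {v} → v < m → P (suc j) v → P j v)
  stabilises = search m 0 (m≤m+n m (size 0))

module _ {n} (S : Diagram n) (s : ℕ) where

  private
    Adjacent : ℕ → ℕ → Set
    Adjacent u v = arc S u v ≡ true ⊎ arc S v u ≡ true

    adjacent? : ∀ u v → Dec (Adjacent u v)
    adjacent? u v = (arc S u v ≟ᵇ true) ⊎-dec (arc S v u ≟ᵇ true)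

    Within : ℕ → ℕ → Set
    Within zero    v = v ≡ s
    Within (suc k) v = Within k v ⊎ ∃[ u ] (u < suc n × Within k u × Adjacent u v)

    within? : ∀ k → Decidable (Within k)
    within? zero    v = v ≟ s
    within? (suc k) v =
      within? k v ⊎-dec anyUpTo? (λ u → within? k u ×-dec adjacent? u v) (suc n)

    within-sound : ∀ k {v} → Within k v → Reach S s v
    within-sound zero    refl                        = here
    within-sound (suc k) (inj₁ w)                    = within-sound k w
    within-sound (suc k) (inj₂ (_ , _ , w , inj₁ e)) = fwd (within-sound k w) e
    within-sound (suc k) (inj₂ (_ , _ , w , inj₂ e)) = bwd (within-sound k w) e

    within-source : ∀ k → Within k s
    within-source zero    = refl
    within-source (suc k) = inj₁ (within-source k)

    within-complete : ∀ j → (∀ {v} → v < suc n → Within (suc j) v → Within j v) →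
                      ∀ {v} → Reach S s v → Within j v
    within-complete j stable here = within-source j
    within-complete j stable (fwd {y} {z} r e) with arc-wf S y z e
    ... | _ , y<z , z≤bound = stable (s≤s z≤bound)
      (inj₂ (y , m<n⇒m<1+n (<-≤-trans y<z z≤bound) , within-complete j stable r , inj₁ e))
    within-complete j stable (bwd {y} {z} r e) with arc-wf S z y e
    ... | _ , z<y , y≤n = stable (m<n⇒m<1+n (<-≤-trans z<y y≤n))
      (inj₂ (y , s≤s y≤n , within-complete j stable r , inj₂ e))

  reach? : Decidable (Reach S s)
  reach? v with stabilises within? inj₁ (suc n)
  ... | j , stable = map′ (within-sound j) (within-complete j stable) (within? j v)

inC? : ∀ {n} (S : Diagram n) → Decidable (InC S)
inC? {n} S v = 1 ≤? v ×-dec v ≤? n ×-dec reach? S 1 v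

greatest≤ : ∀ {p} {P : Pred ℕ p} → Decidable P → ∀ {a} v → a ≤ v → P a →
            ∃[ c ] (c ≤ v × P c × (∀ m → c < m → m ≤ v → ¬ P m))
greatest≤ P? v a≤v pa with P? v
... | yes pv = v , ≤-refl , pv , λ _ v<m m≤v _ → <⇒≱ v<m m≤v
greatest≤ P? zero    z≤n  pa | no ¬pv = ⊥-elim (¬pv pa)
greatest≤ P? (suc v) a≤1+v pa | no ¬pv with m≤n⇒m<n∨m≡n a≤1+v
... | inj₂ refl      = ⊥-elim (¬pv pa)
... | inj₁ (s≤s a≤v) with greatest≤ P? v a≤v pa
...   | c , c≤v , pc , gap = c , m≤n⇒m≤1+n c≤v , pc , gap′
  where
  gap′ : ∀ m → c < m → m ≤ suc v → ¬ _
  gap′ m c<m m≤1+v with m≤n⇒m<n∨m≡n m≤1+v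
  ... | inj₁ (s≤s m≤v) = gap m c<m m≤v
  ... | inj₂ refl      = ¬pv

between-or-outside : ∀ {a b z} → z ≢ a → z ≢ b → z < a ⊎ b < z ⊎ (a < z × z < b)
between-or-outside {a} {b} {z} z≢a z≢b with <-cmp z a
... | tri< z<a _ _   = inj₁ z<a
... | tri≈ _ z≡a _   = ⊥-elim (z≢a z≡a)
... | tri> _ _ a<z with <-cmp b z
...   | tri< b<z _ _ = inj₂ (inj₁ b<z)
...   | tri≈ _ b≡z _ = ⊥-elim (z≢b (sym b≡z))
...   | tri> _ _ z<b = inj₂ (inj₂ (a<z , z<b))

module _ {n} {S : Diagram n} where

  inC-arcʳ : ∀ {x y} → arc S x y ≡ true → InC S x → InC S y
  inC-arcʳ {x} {y} xy (_ , _ , r) with arc-wf S x y xy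
  ... | 1≤x , x<y , y≤n = ≤-trans 1≤x (<⇒≤ x<y) , y≤n , fwd r xy

  inC-arcˡ : ∀ {x y} → arc S x y ≡ true → InC S y → InC S x
  inC-arcˡ {x} {y} xy (_ , _ , r) with arc-wf S x y xy
  ... | 1≤x , x<y , y≤n = 1≤x , ≤-trans (<⇒≤ x<y) y≤n , bwd r xy

  interval-start : ∀ {c x m} → InInterval S c x → InC S m → m ≤ x → m ≤ c
  interval-start (_ , _ , _ , gap) m∈C m≤x = ≮⇒≥ λ c<m → gap _ c<m m≤x m∈C

  interval-unreachable : ∀ {c x} → InInterval S c x → ¬ Reach S 1 x
  interval-unreachable (c∈C , c<x , x≤n , gap) r =
    gap _ c<x ≤-refl (≤-trans (proj₁ c∈C) (<⇒≤ c<x) , x≤n , r)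

  ∉C⇒interval : ∀ {v} → 1 ≤ v → v ≤ n → ¬ InC S v → ∃[ c ] InInterval S c v
  ∉C⇒interval {v} 1≤v v≤n v∉C with greatest≤ (inC? S) v 1≤v (≤-refl , ≤-trans 1≤v v≤n , here)
  ... | c , c≤v , c∈C , gap = c , c∈C , ≤∧≢⇒< c≤v (λ { refl → v∉C c∈C }) , v≤n , gap

  stack-reach-outside : IsStack S → ∀ {a b s} → arc S a b ≡ true →
                        ¬ Reach S s a → ¬ Reach S s b → s < a ⊎ b < s →
                        ∀ {w} → Reach S s w → w < a ⊎ b < w
  stack-reach-outside stack ab ¬a ¬b s-out here = s-out
  stack-reach-outside stack {a} {b} ab ¬a ¬b s-out (fwd {y} {z} r yz)
    with between-or-outside {a} {b} (λ { refl → ¬a (fwd r yz) }) (λ { refl → ¬b (fwd r yz) })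
       | stack-reach-outside stack ab ¬a ¬b s-out r
  ... | inj₁ z<a                | _        = inj₁ z<a
  ... | inj₂ (inj₁ b<z)         | _        = inj₂ b<z
  ... | inj₂ (inj₂ (a<z , z<b)) | inj₁ y<a = ⊥-elim (stack y z a b yz ab (y<a , a<z , z<b))
  ... | inj₂ (inj₂ (a<z , z<b)) | inj₂ b<y =
    ⊥-elim (<-asym (proj₁ (proj₂ (arc-wf S y z yz))) (<-trans z<b b<y))
  stack-reach-outside stack {a} {b} ab ¬a ¬b s-out (bwd {y} {z} r zy)
    with between-or-outside {a} {b} (λ { refl → ¬a (bwd r zy) }) (λ { refl → ¬b (bwd r zy) })
       | stack-reach-outside stack ab ¬a ¬b s-out r
  ... | inj₁ z<a                | _        = inj₁ z<a
  ... | inj₂ (inj₁ b<z)         | _        = inj₂ b<z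
  ... | inj₂ (inj₂ (a<z , z<b)) | inj₁ y<a =
    ⊥-elim (<-asym (proj₁ (proj₂ (arc-wf S z y zy))) (<-trans y<a a<z))
  ... | inj₂ (inj₂ (a<z , z<b)) | inj₂ b<y = ⊥-elim (stack a b z y ab zy (a<z , z<b , b<y))

  stack-arc-sameInterval : IsStack S → ∀ {x y c c′} → arc S x y ≡ true →
                           InInterval S c x → InInterval S c′ y → c ≡ c′
  stack-arc-sameInterval stack {x} {y} {c} {c′} xy ix@(c∈C , c<x , _) iy@(c′∈C , c′<y , _) =
    ≤-antisym c≤c′ c′≤c
    where
    x<y : x < y
    x<y = proj₁ (proj₂ (arc-wf S x y xy))

    c≤c′ : c ≤ c′
    c≤c′ = interval-start iy c∈C (<⇒≤ (<-trans c<x x<y))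

    c′≤c : c′ ≤ c
    c′≤c with c′ ≤? x
    ... | yes c′≤x = interval-start ix c′∈C c′≤x
    ... | no c′≰x with stack-reach-outside stack xy (interval-unreachable ix)
                         (interval-unreachable iy) (inj₁ (≤-<-trans (proj₁ c∈C) c<x))
                         (proj₂ (proj₂ c′∈C))
    ...   | inj₁ c′<x = ⊥-elim (c′≰x (<⇒≤ c′<x))
    ...   | inj₂ y<c′ = ⊥-elim (<-asym y<c′ c′<y)

  stack-arc-inC⊎sameInterval : IsStack S → ∀ {x y} → arc S x y ≡ true →
    (InC S x × InC S y) ⊎ (∃[ c ] (InInterval S c x × InInterval S c y))
  stack-arc-inC⊎sameInterval stack {x} {y} xy with arc-wf S x y xy | inC? S x | inC? S y
  ... | _ | yes x∈C | _        = inj₁ (x∈C , inC-arcʳ xy x∈C)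
  ... | _ | no x∉C  | yes y∈C  = ⊥-elim (x∉C (inC-arcˡ xy y∈C))
  ... | 1≤x , x<y , y≤n | no x∉C | no y∉C
    with ∉C⇒interval 1≤x (≤-trans (<⇒≤ x<y) y≤n) x∉C
       | ∉C⇒interval (≤-trans 1≤x (<⇒≤ x<y)) y≤n y∉C
  ...   | c , ix | c′ , iy with stack-arc-sameInterval stack xy ix iy
  ...     | refl = inj₂ (c , ix , iy)

mainTheorem2 : (n : ℕ) → 1 ≤ n → (S : Diagram n) → IsZigzagStack S →
    (∀ x y c c' → arc S x y ≡ true → InInterval S c x → InInterval S c' y → c ≡ c')
    ×
    (∀ x y → arc S x y ≡ true →
    (InC S x × InC S y) ⊎ (∃[ c ] (InInterval S c x × InInterval S c y)))
mainTheorem2 n _ S (stack , _) =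
  (λ _ _ _ _ → stack-arc-sameInterval stack) , (λ _ _ → stack-arc-inC⊎sameInterval stack)
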